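{- Let $\Phi$ be a block contig, $B,W\in\mathcal{B}(\Phi)$ non-adjacent in $\mathcal{G}(\Phi)$, and $v\in B$, $w\in W$. If $G(\Phi)\cup\{vw\}$ is a PCA graph that is not a proper interval graph, $G(\Phi)$ is co-connected, and neither $G(\Phi)\setminus\{v\}$ nor $G(\Phi)\setminus\{w\}$ is co-connected, then either $(B,W)$ or $(W,B)$ is connectable in $\Phi$.
   Context: An ordered semiblock family is a sequence $B_1,\dots,B_k$ of pairwise disjoint nonempty sets (semiblocks); indices modulo $k$; $[B_i,B_j]$ is $B_i,\dots,B_j$ and $(B_i,B_j]$ deletes its first element. A round representation is $\Phi=(\mathcal{B}(\Phi),F_r)$ with $F_r(B_i)\in[B_i,F_r(B_{i+1})]$ for all $i$; $B\to W$ means $W\in(B,F_r(B)]$; representations are normal (never both $B\to W$ and $W\to B$). $L(B_i)=B_{i-1}$, $R(B_i)=B_{i+1}$; $F_l(B_i)$ is the unique $B_j$ with ($B_j\to B_i$ or $B_j=B_i$) and ($B_{j-1}=B_i$ or $B_{j-1}\not\to B_i$); $U_r(B)=R(F_r(B))$, $U_l(B)=L(F_l(B))$. The round graph $\mathcal{G}(\Phi)$ has vertex set $\mathcal{B}(\Phi)$, $B,W$ adjacent iff $B\to W$ or $W\to B$. $G(\Phi)$ is the graph on $\bigcup\mathcal{B}(\Phi)$ where distinct $x\in B$, $y\in W$ are adjacent iff $B=W$ or $B,W$ adjacent in $\mathcal{G}(\Phi)$. $\Phi$ is a contig if $\mathcal{G}(\Phi)$ is connected, and a block contig if moreover no two distinct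 semiblocks have equal closed neighborhoods in $\mathcal{G}(\Phi)$. A pair $(B_a,B_b)$ of distinct semiblocks is connectable in $\Phi$ if $B_b=U_r(B_a)$ and $B_a=U_l(B_b)$. A PCA graph is an intersection graph of circle arcs none properly containing another; a proper interval graph is an intersection graph of intervals of the line none properly containing another. Co-connected means having connected complement. -}

module Defs where

open import Data.Nat as ℕ using (ℕ; zero; suc; _∸_; _+_)
import Data.Nat.Properties as ℕP
open import Data.Fin using (Fin; zero; suc; toℕ; fromℕ; fromℕ<; inject₁)
open import Data.Rational as ℚ using (ℚ; 0ℚ; 1ℚ)
open import Data.Product using (Σ; ∃; _×_; _,_)
open import Data.Sum using (_⊎_)
open import Relation.Nullary using (¬_; yes; no)
open import Relation.Binary.PropositionalEquality using (_≡_; _≢_)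
open import Relation.Binary.Construct.Closure.ReflexiveTransitive using (Star)

Connected : {V : Set} → (V → V → Set) → Set
Connected {V} E = (x y : V) → Star E x y

Compl : {V : Set} → (V → V → Set) → (V → V → Set)
Compl E x y = x ≢ y × ¬ E x y

CoConnected : {V : Set} → (V → V → Set) → Set
CoConnected E = Connected (Compl E)

DelVertex : {V : Set} → (V → V → Set) → (v : V) →
            Σ V (λ x → x ≢ v) → Σ V (λ x → x ≢ v) → Set
DelVertex E v (x , _) (y , _) = E x y

AddEdge : {V : Set} → (V → V → Set) → V → V → (V → V → Set)
AddEdge E v w x y = E x y ⊎ ((x ≡ v × y ≡ w) ⊎ (x ≡ w × y ≡ v))

-- Arcs on the circle ℚ ∩ [0,1) (closed arcs, traversed counterclockwise
-- from s to t) and closed intervals of the line ℚ.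

OnCircle : ℚ → Set
OnCircle p = 0ℚ ℚ.≤ p × p ℚ.< 1ℚ

record Arc : Set where
  field
    s t : ℚ
    s-on : OnCircle s
    t-on : OnCircle t

InArc : Arc → ℚ → Set
InArc a p = OnCircle p ×
  ((Arc.s a ℚ.≤ Arc.t a × Arc.s a ℚ.≤ p × p ℚ.≤ Arc.t a)
   ⊎ (Arc.t a ℚ.< Arc.s a × (Arc.s a ℚ.≤ p ⊎ p ℚ.≤ Arc.t a)))

record Interval : Set where
  field
    l r : ℚ
    l≤r : l ℚ.≤ r

InInterval : Interval → ℚ → Set
InInterval I p = Interval.l I ℚ.≤ p × p ℚ.≤ Interval.r I

Meet : {P : Set} → (P → Set) → (P → Set) → Set
Meet {P} A B = Σ P (λ p → A p × B p)

Subset : {P : Set} → (P → Set) → (P → Set) → Set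
Subset {P} A B = (p : P) → A p → B p

ProperSubset : {P : Set} → (P → Set) → (P → Set) → Set
ProperSubset A B = Subset A B × ¬ Subset B A

IsProperIntersectionModel : {V P : Set} → (V → V → Set) → (V → P → Set) → Set
IsProperIntersectionModel {V} E S =
  ((x y : V) → x ≢ y → (E x y → Meet (S x) (S y)) × (Meet (S x) (S y) → E x y))
  × ((x y : V) → x ≢ y → ¬ ProperSubset (S x) (S y))

IsPCA : {V : Set} → (V → V → Set) → Set
IsPCA {V} E = Σ (V → Arc) (λ arc → IsProperIntersectionModel E (λ x → InArc (arc x)))

IsPIG : {V : Set} → (V → V → Set) → Set
IsPIG {V} E = Σ (V → Interval) (λ iv → IsProperIntersectionModel E (λ x → InInterval (iv x)))

-- Cyclic indices Fin k (semiblock B_i is index i).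

-- R (successor modulo k) and L (predecessor modulo k)
sucC : {k : ℕ} → Fin k → Fin k
sucC {suc m} i with toℕ i ℕ.<? m
... | yes p = fromℕ< (ℕ.s≤s p)
... | no _ = zero

predC : {k : ℕ} → Fin k → Fin k
predC {suc m} zero = fromℕ m
predC {suc m} (suc j) = inject₁ j

dist : {k : ℕ} → Fin k → Fin k → ℕ
dist {k} i j with toℕ i ℕ.≤? toℕ j
... | yes _ = toℕ j ∸ toℕ i
... | no _ = (k ∸ toℕ i) + toℕ j

InCC : {k : ℕ} → Fin k → Fin k → Fin k → Set
InCC i j l = dist i j ℕ.≤ dist i l

InOC : {k : ℕ} → Fin k → Fin k → Fin k → Set
InOC i j l = 0 ℕ.< dist i j × dist i j ℕ.≤ dist i l

-- The vertices of G(Φ) are Fin n; blk x is the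
-- semiblock containing x (so semiblocks are pairwise disjoint and cover
-- the vertex set); surjectivity says every semiblock is nonempty.

Arrow : {k : ℕ} → (Fin k → Fin k) → Fin k → Fin k → Set
Arrow Fr b w = InOC b w (Fr b)

record RoundRep (n k : ℕ) : Set where
  field
    blk    : Fin n → Fin k
    nonempty : (i : Fin k) → ∃ (λ x → blk x ≡ i)
    Fr     : Fin k → Fin k
    round  : (i : Fin k) → InCC i (Fr i) (Fr (sucC i))
    normal : (b w : Fin k) → ¬ (Arrow Fr b w × Arrow Fr w b)

module _ {n k : ℕ} (Φ : RoundRep n k) where
  open RoundRep Φ

  _⟶_ : Fin k → Fin k → Set
  b ⟶ w = Arrow Fr b w

  RAdj : Fin k → Fin k → Set
  RAdj b w = (b ⟶ w) ⊎ (w ⟶ b)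

  GAdj : Fin n → Fin n → Set
  GAdj x y = x ≢ y × (blk x ≡ blk y ⊎ RAdj (blk x) (blk y))

  IsContig : Set
  IsContig = Connected RAdj

  ClosedNbhd : Fin k → Fin k → Set
  ClosedNbhd b x = x ≡ b ⊎ RAdj b x

  IsBlockContig : Set
  IsBlockContig = IsContig ×
    ((b w : Fin k) → b ≢ w →
      ¬ ((x : Fin k) → (ClosedNbhd b x → ClosedNbhd w x) × (ClosedNbhd w x → ClosedNbhd b x)))

  -- "B_j = F_l(B_i)": (B_j → B_i or B_j = B_i) and (B_{j-1} = B_i or not B_{j-1} → B_i)
  IsFl : Fin k → Fin k → Set
  IsFl i j = ((j ⟶ i) ⊎ j ≡ i) × (predC j ≡ i ⊎ ¬ (predC j ⟶ i))

  Ur : Fin k → Fin k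
  Ur b = sucC (Fr b)

  -- (B_a, B_b) connectable: distinct, B_b = U_r(B_a), B_a = U_l(B_b) = L(F_l(B_b))
  Connectable : Fin k → Fin k → Set
  Connectable a b = a ≢ b × b ≡ Ur a × ∃ (λ f → IsFl b f × a ≡ predC f)

-- Write X ⇒⁼ Y for "X → Y or X = Y", and measure positions from B by p X = dist B X.
-- The semiblocks non-adjacent to B ("far" from B) form an interval for p.  If every far semiblock,
-- and every two consecutive far ones, had a common non-neighbour other than B, then the
-- non-neighbours of v ∈ B would all be joined in the complement of G(Φ) − v, which would
-- therefore be co-connected.  Hence there is a break: far u and u' ∈ {u, R(u)} with no
-- such common non-neighbour.  As neither R(B) nor L(B) can be one, R(B) ⇒⁼ u and
-- u' ⇒⁼ L(B), and where W lies relative to the break decides which of R(B) ⇒⁼ W and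
-- W ⇒⁼ L(B) hold and which of their mirror images for (W, B) fail.  Combined with the
-- same analysis from W's side this gives R(X) ⇒⁼ Y and X ⇒⁼ L(Y) for (X, Y) = (B, W) or
-- (W, B), which for non-adjacent X, Y makes (X, Y) connectable.

module Submission where

open import Defs
open import Data.Nat as ℕ using (ℕ; zero; suc; _+_; _∸_; _≤_; _<_; z≤n; s≤s; s≤s⁻¹; _%_)
open import Data.Nat.Properties
open import Data.Nat.DivMod
open import Data.Fin as Fin using (Fin; toℕ)
import Data.Fin.Properties as Finₚ
open import Data.Product using (_×_; Σ; Σ-syntax; _,_; proj₁; proj₂)
open import Data.Sum using (_⊎_; inj₁; inj₂; [_,_]′; swap)
open import Data.Empty using (⊥-elim)
open import Relation.Nullary using (¬_; Dec; yes; no; ¬?; _×-dec_; _⊎-dec_; _→-dec_)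
open import Relation.Binary.Definitions using (DecidableEquality; Symmetric)
open import Relation.Binary.Construct.Closure.ReflexiveTransitive using (Star; ε; _◅_; _◅◅_; reverse)
open import Relation.Binary.PropositionalEquality
open import Function using (_∘_)

module _ {m : ℕ} where
  private
    k : ℕ
    k = suc m

  %-cong-+ʳ : ∀ a b e → a % k ≡ b % k → (a + e) % k ≡ (b + e) % k
  %-cong-+ʳ a b e eq = begin
    (a + e) % k                 ≡⟨ %-distribˡ-+ a e k ⟩
    (a % k + e % k) % k         ≡⟨ cong (λ t → (t + e % k) % k) eq ⟩
    (b % k + e % k) % k         ≡⟨ %-distribˡ-+ b e k ⟨
    (b + e) % k                 ∎
    where open ≡-Reasoning

  +-%-cancelˡ : ∀ x {d d'} → d < k → d' < k → (x + d) % k ≡ (x + d') % k → d ≡ d'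
  +-%-cancelˡ x {d} {d'} d<k d'<k eq = begin
    d                   ≡⟨ unshift d<k ⟩
    ((x + d) + s) % k   ≡⟨ %-cong-+ʳ (x + d) (x + d') s eq ⟩
    ((x + d') + s) % k  ≡⟨ unshift d'<k ⟨
    d'                  ∎
    where
      open ≡-Reasoning
      s = k ∸ x % k
      x+s≡0 : (x + s) % k ≡ 0 % k
      x+s≡0 = begin
        (x + s) % k        ≡⟨ %-cong-+ʳ (x % k) x s (m%n%n≡m%n x k) ⟨
        (x % k + s) % k    ≡⟨ cong (_% k) (m+[n∸m]≡n (m%n≤n x k)) ⟩
        k % k              ≡⟨ n%n≡0 k ⟩
        0                  ∎
      unshift : ∀ {e} → e < k → e ≡ ((x + e) + s) % k
      unshift {e} e<k = begin
        e                  ≡⟨ m<n⇒m%n≡m e<k ⟨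
        e % k              ≡⟨ %-cong-+ʳ (x + s) 0 e x+s≡0 ⟨
        ((x + s) + e) % k  ≡⟨ cong (_% k) (+-assoc x s e) ⟩
        (x + (s + e)) % k  ≡⟨ cong (λ t → (x + t) % k) (+-comm s e) ⟩
        (x + (e + s)) % k  ≡⟨ cong (_% k) (+-assoc x e s) ⟨
        ((x + e) + s) % k  ∎

  toℕ%≡toℕ : ∀ (j : Fin k) → toℕ j % k ≡ toℕ j
  toℕ%≡toℕ j = m<n⇒m%n≡m (Finₚ.toℕ<n j)

  -- dist i j is handled as the unique d with Offset i j d.
  record Offset (i j : Fin k) (d : ℕ) : Set where
    constructor offset
    field
      bound : d < k
      lands : (toℕ i + d) % k ≡ toℕ j

  offset-dist : ∀ i j → Offset i j (dist i j)
  offset-dist i j with toℕ i ℕ.≤? toℕ j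
  ... | yes i≤j = offset (≤-<-trans (m∸n≤m (toℕ j) (toℕ i)) j<k)
                       (trans (cong (_% k) (m+[n∸m]≡n i≤j)) (toℕ%≡toℕ j))
    where j<k = Finₚ.toℕ<n j
  ... | no i≰j = offset wrapped<k wrapped%k
    where
      i≤k : toℕ i ≤ k
      i≤k = <⇒≤ (Finₚ.toℕ<n i)
      wrapped<k : (k ∸ toℕ i) + toℕ j < k
      wrapped<k = begin-strict
        (k ∸ toℕ i) + toℕ j  <⟨ +-monoʳ-< (k ∸ toℕ i) (≰⇒> i≰j) ⟩
        (k ∸ toℕ i) + toℕ i  ≡⟨ m∸n+n≡m i≤k ⟩
        k                    ∎
        where open ≤-Reasoning
      wrapped%k : (toℕ i + ((k ∸ toℕ i) + toℕ j)) % k ≡ toℕ j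
      wrapped%k = begin
        (toℕ i + ((k ∸ toℕ i) + toℕ j)) % k  ≡⟨ cong (_% k) (+-assoc (toℕ i) (k ∸ toℕ i) (toℕ j)) ⟨
        ((toℕ i + (k ∸ toℕ i)) + toℕ j) % k  ≡⟨ cong (λ t → (t + toℕ j) % k) (m+[n∸m]≡n i≤k) ⟩
        (k + toℕ j) % k                      ≡⟨ cong (_% k) (+-comm k (toℕ j)) ⟩
        (toℕ j + k) % k                      ≡⟨ [m+n]%n≡m%n (toℕ j) k ⟩
        toℕ j % k                            ≡⟨ toℕ%≡toℕ j ⟩
        toℕ j                                ∎
        where open ≡-Reasoning

  offset-unique : ∀ {i j d d'} → Offset i j d → Offset i j d' → d ≡ d'
  offset-unique {i} (offset d<k eq) (offset d'<k eq') = +-%-cancelˡ (toℕ i) d<k d'<k (trans eq (sym eq'))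

  offset-injective : ∀ {i j j' d} → Offset i j d → Offset i j' d → j ≡ j'
  offset-injective (offset _ eq) (offset _ eq') = Finₚ.toℕ-injective (trans (sym eq) eq')

  dist-unique : ∀ {i j d} → Offset i j d → dist i j ≡ d
  dist-unique {i} {j} = offset-unique (offset-dist i j)

  dist< : ∀ (i j : Fin k) → dist i j < k
  dist< i j = Offset.bound (offset-dist i j)

  dist-injectiveʳ : ∀ {i j j' : Fin k} → dist i j ≡ dist i j' → j ≡ j'
  dist-injectiveʳ {i} {j} {j'} eq =
    offset-injective (offset-dist i j) (subst (Offset i j') (sym eq) (offset-dist i j'))

  dist-refl : ∀ (i : Fin k) → dist i i ≡ 0
  dist-refl i = dist-unique {i} {i}
    (offset (s≤s z≤n) (trans (cong (_% k) (+-identityʳ (toℕ i))) (toℕ%≡toℕ i)))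

  dist≡0⇒≡ : ∀ {i j : Fin k} → dist i j ≡ 0 → i ≡ j
  dist≡0⇒≡ {i} {j} eq = dist-injectiveʳ {i} {i} {j} (trans (dist-refl i) (sym eq))

  toℕ-sucC : ∀ (j : Fin k) → toℕ (sucC j) ≡ suc (toℕ j) % k
  toℕ-sucC j with toℕ j ℕ.<? m
  ... | yes j<m = trans (Finₚ.toℕ-fromℕ< (s≤s j<m)) (sym (m<n⇒m%n≡m (s≤s j<m)))
  ... | no j≮m = sym (trans (cong (λ t → suc t % k) j≡m) (n%n≡0 k))
    where
      j≡m : toℕ j ≡ m
      j≡m = ≤-antisym (≤-pred (Finₚ.toℕ<n j)) (≮⇒≥ j≮m)

  sucC-injective : ∀ {i j : Fin k} → sucC i ≡ sucC j → i ≡ j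
  sucC-injective {i} {j} eq = Finₚ.toℕ-injective (+-%-cancelˡ 1 (Finₚ.toℕ<n i) (Finₚ.toℕ<n j)
    (trans (sym (toℕ-sucC i)) (trans (cong toℕ eq) (toℕ-sucC j))))

  sucC-predC : ∀ (j : Fin k) → sucC (predC j) ≡ j
  sucC-predC j = Finₚ.toℕ-injective (trans (toℕ-sucC (predC j)) (suc-predC j))
    where
      suc-predC : ∀ (j : Fin k) → suc (toℕ (predC j)) % k ≡ toℕ j
      suc-predC Fin.zero = trans (cong (λ t → suc t % k) (Finₚ.toℕ-fromℕ m)) (n%n≡0 k)
      suc-predC (Fin.suc j) = trans (cong (λ t → suc t % k) (Finₚ.toℕ-inject₁ j)) (toℕ%≡toℕ (Fin.suc j))

  predC-sucC : ∀ (j : Fin k) → predC (sucC j) ≡ j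
  predC-sucC j = sucC-injective (sucC-predC (sucC j))

  offset-sucC : ∀ {i j d} → Offset i j d → (toℕ i + suc d) % k ≡ toℕ (sucC j)
  offset-sucC {i} {j} {d} (offset _ eq) = begin
    (toℕ i + suc d) % k    ≡⟨ cong (_% k) (+-suc (toℕ i) d) ⟩
    suc (toℕ i + d) % k    ≡⟨ cong (_% k) (+-comm 1 (toℕ i + d)) ⟩
    ((toℕ i + d) + 1) % k  ≡⟨ %-cong-+ʳ (toℕ i + d) (toℕ j) 1 (trans eq (sym (toℕ%≡toℕ j))) ⟩
    (toℕ j + 1) % k        ≡⟨ cong (_% k) (+-comm (toℕ j) 1) ⟩
    suc (toℕ j) % k        ≡⟨ toℕ-sucC j ⟨
    toℕ (sucC j)           ∎
    where open ≡-Reasoning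

  dist-sucC : ∀ (i j : Fin k) → sucC j ≢ i → dist i (sucC j) ≡ suc (dist i j)
  dist-sucC i j sucCj≢i with m≤n⇒m<n∨m≡n (dist< i j)
  ... | inj₁ 1+d<k = dist-unique {i} {sucC j} (offset 1+d<k (offset-sucC (offset-dist i j)))
  ... | inj₂ 1+d≡k = ⊥-elim (sucCj≢i (Finₚ.toℕ-injective (sym (begin
    toℕ i                         ≡⟨ toℕ%≡toℕ i ⟨
    toℕ i % k                     ≡⟨ [m+n]%n≡m%n (toℕ i) k ⟨
    (toℕ i + k) % k               ≡⟨ cong (λ t → (toℕ i + t) % k) 1+d≡k ⟨
    (toℕ i + suc (dist i j)) % k  ≡⟨ offset-sucC (offset-dist i j) ⟩
    toℕ (sucC j)                  ∎))))
    where open ≡-Reasoning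

  offset-+ : ∀ {i j l d e} → Offset i j d → Offset j l e → (toℕ i + (d + e)) % k ≡ toℕ l
  offset-+ {i} {j} {l} {d} {e} (offset _ eq₁) (offset _ eq₂) = begin
    (toℕ i + (d + e)) % k  ≡⟨ cong (_% k) (+-assoc (toℕ i) d e) ⟨
    ((toℕ i + d) + e) % k  ≡⟨ %-cong-+ʳ (toℕ i + d) (toℕ j) e (trans eq₁ (sym (toℕ%≡toℕ j))) ⟩
    (toℕ j + e) % k        ≡⟨ eq₂ ⟩
    toℕ l                  ∎
    where open ≡-Reasoning

  dist-+-dist : ∀ (i j l : Fin k) → dist i j + dist j l ≡ dist i l ⊎ dist i j + dist j l ≡ dist i l + k
  dist-+-dist i j l with <-≤-connex (dist i j + dist j l) k
  ... | inj₁ s<k = inj₁ (sym (dist-unique {i} {l} (offset s<k (offset-+ (offset-dist i j) (offset-dist j l)))))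
  ... | inj₂ k≤s =
    inj₂ (trans (sym (m∸n+n≡m k≤s)) (cong (_+ k) (sym (dist-unique {i} {l} (offset s∸k<k s∸k%k)))))
    where
      open ≡-Reasoning
      s = dist i j + dist j l
      s∸k<k : s ∸ k < k
      s∸k<k = +-cancelʳ-< k (s ∸ k) k (subst (_< k + k) (sym (m∸n+n≡m k≤s)) (+-mono-< (dist< i j) (dist< j l)))
      s∸k%k : (toℕ i + (s ∸ k)) % k ≡ toℕ l
      s∸k%k = begin
        (toℕ i + (s ∸ k)) % k        ≡⟨ [m+n]%n≡m%n (toℕ i + (s ∸ k)) k ⟨
        ((toℕ i + (s ∸ k)) + k) % k  ≡⟨ cong (_% k) (+-assoc (toℕ i) (s ∸ k) k) ⟩
        (toℕ i + ((s ∸ k) + k)) % k  ≡⟨ cong (λ t → (toℕ i + t) % k) (m∸n+n≡m k≤s) ⟩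
        (toℕ i + s) % k              ≡⟨ offset-+ (offset-dist i j) (offset-dist j l) ⟩
        toℕ l                        ∎

  dist-split : ∀ (i j l : Fin k) → dist i j ≤ dist i l → dist i l ≡ dist i j + dist j l
  dist-split i j l ij≤il with dist-+-dist i j l
  ... | inj₁ eq = sym eq
  ... | inj₂ eq = ⊥-elim (<⇒≱ (+-monoʳ-< (dist i j) (dist< j l)) (begin
    dist i j + k         ≤⟨ +-monoˡ-≤ k ij≤il ⟩
    dist i l + k         ≡⟨ eq ⟨
    dist i j + dist j l  ∎))
    where open ≤-Reasoning

  dist-sum : ∀ {i j : Fin k} → i ≢ j → dist i j + dist j i ≡ k
  dist-sum {i} {j} i≢j with dist-+-dist i j i
  ... | inj₁ eq = ⊥-elim (i≢j (dist≡0⇒≡ (m+n≡0⇒m≡0 (dist i j) (trans eq (dist-refl i)))))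
  ... | inj₂ eq = trans eq (cong (_+ k) (dist-refl i))

module _ {m : ℕ} where
  private
    k : ℕ
    k = suc (suc m)

  dist-sucC-self : ∀ (x : Fin k) → dist x (sucC x) ≡ 1
  dist-sucC-self x = dist-unique {i = x} (offset (s≤s (s≤s z≤n))
    (trans (cong (_% k) (+-comm (toℕ x) 1)) (sym (toℕ-sucC x))))

  sucC≢ : ∀ (x : Fin k) → sucC x ≢ x
  sucC≢ x eq = 1+n≢0 (trans (sym (dist-sucC-self x)) (trans (cong (dist x) eq) (dist-refl x)))

  predC≢ : ∀ (x : Fin k) → predC x ≢ x
  predC≢ x eq = sucC≢ (predC x) (trans (sucC-predC x) (sym eq))

  dist-predC-self : ∀ (x : Fin k) → dist x (predC x) ≡ suc m
  dist-predC-self x = +-cancelʳ-≡ 1 _ _ (begin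
    dist x (predC x) + 1                 ≡⟨ cong (dist x (predC x) +_) back ⟨
    dist x (predC x) + dist (predC x) x  ≡⟨ dist-sum (predC≢ x ∘ sym) ⟩
    k                                    ≡⟨ +-comm 1 (suc m) ⟩
    suc m + 1                            ∎)
    where
      open ≡-Reasoning
      back : dist (predC x) x ≡ 1
      back = trans (cong (dist (predC x)) (sym (sucC-predC x))) (dist-sucC-self (predC x))

  dist-stepˡ : ∀ {x y : Fin k} → 0 < dist x y → dist x y ≡ suc (dist (sucC x) y)
  dist-stepˡ {x} {y} 0<xy =
    trans (dist-split x (sucC x) y (subst (_≤ dist x y) (sym (dist-sucC-self x)) 0<xy))
          (cong (_+ dist (sucC x) y) (dist-sucC-self x))

module DeleteVertex {V : Set} (_≟_ : DecidableEquality V) (E : V → V → Set) (E-sym : Symmetric E) (v : V) where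
  private
    C : V → V → Set
    C = Compl E

    C-sym : Symmetric C
    C-sym (x≢y , ¬xy) = x≢y ∘ sym , ¬xy ∘ E-sym

    Cᵥ : Σ V (_≢ v) → Σ V (_≢ v) → Set
    Cᵥ = Compl (DelVertex E v)

    Cᵥ-sym : Symmetric Cᵥ
    Cᵥ-sym (x≢y , ¬xy) = x≢y ∘ sym , ¬xy ∘ E-sym

  -- All proofs of x ≢ v are quantified over, as they cannot be shown equal.
  Joined : V → V → Set
  Joined x y = ∀ x≢v y≢v → Star Cᵥ (x , x≢v) (y , y≢v)

  joined-edge : ∀ {x y} → C x y → Joined x y
  joined-edge (x≢y , ¬xy) _ _ = (x≢y ∘ cong proj₁ , ¬xy) ◅ ε

  joined-trans : ∀ {x y z} → y ≢ v → Joined x y → Joined y z → Joined x z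
  joined-trans y≢v xy yz x≢v z≢v = xy x≢v y≢v ◅◅ yz y≢v z≢v

  joined-sym : ∀ {x y} → Joined x y → Joined y x
  joined-sym xy y≢v x≢v = reverse Cᵥ-sym (xy x≢v y≢v)

  NeighboursJoined : Set
  NeighboursJoined = ∀ {a b} → C v a → C v b → Joined a b

  module _ (coConn : CoConnected E) (nbrs : NeighboursJoined) where

    joined-refl : ∀ {x} → x ≢ v → Joined x x
    joined-refl {x} x≢v = through (coConn x v) refl
      where
        through : ∀ {y} → Star C x y → y ≡ v → Joined x x
        through ε x≡v = ⊥-elim (x≢v x≡v)
        through (_◅_ {j = y} xy _) _ with y ≟ v
        ... | yes refl = nbrs (C-sym xy) (C-sym xy)
        ... | no y≢v = joined-trans y≢v (joined-edge xy) (joined-edge (C-sym xy))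

    joined-along : ∀ {x y} → Star C x y → y ≢ v →
                   (x ≢ v → Joined x y) × (x ≡ v → ∀ {a} → C v a → Joined a y)
    joined-along ε y≢v = (λ _ → joined-refl y≢v) , (λ y≡v → ⊥-elim (y≢v y≡v))
    joined-along (_◅_ {j = q} xq qy) y≢v with joined-along qy y≢v | q ≟ v
    ... | _ , from-v | yes refl = (λ _ → from-v refl (C-sym xq)) , (λ { refl → ⊥-elim (proj₁ xq refl) })
    ... | from-q , _ | no q≢v =
      (λ _ → joined-trans q≢v (joined-edge xq) (from-q q≢v)) ,
      (λ { refl va → joined-trans q≢v (nbrs va xq) (from-q q≢v) })

    coConnected-deleteVertex : CoConnected (DelVertex E v)
    coConnected-deleteVertex (x , x≢v) (y , y≢v) = proj₁ (joined-along (coConn x y) y≢v) x≢v x≢v y≢v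

module RoundRepFacts {n m : ℕ} (Φ : RoundRep n (suc (suc m))) where
  open RoundRep Φ

  private
    K : ℕ
    K = suc (suc m)

  _⇒_ : Fin K → Fin K → Set
  _⇒_ = _⟶_ Φ

  _⇒⁼_ : Fin K → Fin K → Set
  x ⇒⁼ y = x ⇒ y ⊎ x ≡ y

  _⇒?_ : ∀ x y → Dec (x ⇒ y)
  x ⇒? y = (0 ℕ.<? dist x y) ×-dec (dist x y ℕ.≤? dist x (Fr x))

  _⇒⁼?_ : ∀ x y → Dec (x ⇒⁼ y)
  x ⇒⁼? y = (x ⇒? y) ⊎-dec (x Finₚ.≟ y)

  Apart : Fin K → Fin K → Set
  Apart x y = x ≢ y × ¬ RAdj Φ x y

  apart? : ∀ x y → Dec (Apart x y)
  apart? x y = ¬? (x Finₚ.≟ y) ×-dec ¬? ((x ⇒? y) ⊎-dec (y ⇒? x))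

  apart-sym : ∀ {x y} → Apart x y → Apart y x
  apart-sym (x≢y , ¬adj) = x≢y ∘ sym , ¬adj ∘ swap

  ⇒-irrefl : ∀ {x y} → x ⇒ y → x ≢ y
  ⇒-irrefl {x} (0<xy , _) refl = <⇒≢ 0<xy (sym (dist-refl x))

  ⇒⁼-strict : ∀ {x y} → x ⇒⁼ y → x ≢ y → x ⇒ y
  ⇒⁼-strict (inj₁ x⇒y) _ = x⇒y
  ⇒⁼-strict (inj₂ x≡y) x≢y = ⊥-elim (x≢y x≡y)

  ⇒⁼-dist : ∀ {x y} → x ⇒⁼ y → dist x y ≤ dist x (Fr x)
  ⇒⁼-dist (inj₁ (_ , xy≤)) = xy≤
  ⇒⁼-dist {x} (inj₂ refl) = subst (_≤ dist x (Fr x)) (sym (dist-refl x)) z≤n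

  ⇒⁼-shorten : ∀ {x y z} → x ⇒⁼ y → dist x z ≤ dist x y → x ⇒⁼ z
  ⇒⁼-shorten {x} {y} {z} x⇒⁼y xz≤xy with x Finₚ.≟ z
  ... | yes x≡z = inj₂ x≡z
  ... | no x≢z = inj₁ (n≢0⇒n>0 (x≢z ∘ dist≡0⇒≡ {i = x} {j = z}) , ≤-trans xz≤xy (⇒⁼-dist x⇒⁼y))

  ⇒-sucC : ∀ {x y} → x ⇒ y → sucC x ≢ y → sucC x ⇒ y
  ⇒-sucC {x} {y} (0<xy , xy≤) x'≢y = n≢0⇒n>0 (x'≢y ∘ dist≡0⇒≡ {i = x'} {j = y}) , s≤s⁻¹ (begin
    suc (dist x' y)         ≡⟨ dist-stepˡ {x = x} {y = y} 0<xy ⟨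
    dist x y                ≤⟨ ≤-trans xy≤ (round x) ⟩
    dist x (Fr x')          ≡⟨ dist-stepˡ {x = x} {y = Fr x'} (<-≤-trans 0<xy (≤-trans xy≤ (round x))) ⟩
    suc (dist x' (Fr x'))   ∎)
    where
      open ≤-Reasoning
      x' = sucC x

  ⇒-between : ∀ d {x y z} → dist x z ≡ suc d → dist x z < dist x y → x ⇒ y → z ⇒ y
  ⇒-between d {x} {y} {z} xz≡1+d xz<xy x⇒y =
    subst (_⇒ y) z⁻⁺≡z (⇒-sucC {z⁻} {y} (z⁻⇒y d xz⁻≡d) z⁻⁺≢y)
    where
      z⁻ = predC z
      z⁻⁺≡z : sucC z⁻ ≡ z
      z⁻⁺≡z = sucC-predC z
      z⁻⁺≢x : sucC z⁻ ≢ x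
      z⁻⁺≢x eq = 1+n≢0 (trans (sym xz≡1+d) (trans (cong (dist x) (trans (sym z⁻⁺≡z) eq)) (dist-refl x)))
      z⁻⁺≢y : sucC z⁻ ≢ y
      z⁻⁺≢y eq = <-irrefl (cong (dist x) (trans (sym z⁻⁺≡z) eq)) xz<xy
      xz⁻≡d : dist x z⁻ ≡ d
      xz⁻≡d = suc-injective (begin
        suc (dist x z⁻)   ≡⟨ dist-sucC x z⁻ z⁻⁺≢x ⟨
        dist x (sucC z⁻)  ≡⟨ cong (dist x) z⁻⁺≡z ⟩
        dist x z          ≡⟨ xz≡1+d ⟩
        suc d             ∎)
        where open ≡-Reasoning
      xz⁻<xy : dist x z⁻ < dist x y
      xz⁻<xy = <-trans (subst₂ _<_ (sym xz⁻≡d) (sym xz≡1+d) (n<1+n d)) xz<xy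
      z⁻⇒y : ∀ e → dist x z⁻ ≡ e → z⁻ ⇒ y
      z⁻⇒y zero xz⁻≡0 = subst (_⇒ y) (dist≡0⇒≡ {i = x} {j = z⁻} xz⁻≡0) x⇒y
      z⁻⇒y (suc e) xz⁻≡1+e = ⇒-between e {x} {y} {z⁻} xz⁻≡1+e xz⁻<xy x⇒y

  ⇒⁼-between : ∀ {x y z} → x ⇒⁼ y → dist x z ≤ dist x y → z ⇒⁼ y
  ⇒⁼-between {x} {y} {z} x⇒⁼y xz≤xy with z Finₚ.≟ y | dist x z in xz≡
  ... | yes z≡y | _ = inj₂ z≡y
  ... | no _ | zero = subst (_⇒⁼ y) (dist≡0⇒≡ {i = x} {j = z} xz≡) x⇒⁼y
  ... | no z≢y | suc d = inj₁ (⇒-between d {x} {y} {z} xz≡ xz<xy (⇒⁼-strict x⇒⁼y x≢y))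
    where
      xz<xy : dist x z < dist x y
      xz<xy = subst (_< dist x y) (sym xz≡)
                (≤∧≢⇒< xz≤xy (λ eq → z≢y (dist-injectiveʳ {i = x} (trans xz≡ eq))))
      x≢y : x ≢ y
      x≢y refl = n≮0 (subst (suc d ≤_) (dist-refl x) xz≤xy)

  ⇒⁼-sucC-source : ∀ {x y} → x ⇒⁼ y → x ≢ y → sucC x ⇒⁼ y
  ⇒⁼-sucC-source {x} {y} x⇒⁼y x≢y with sucC x Finₚ.≟ y
  ... | yes x⁺≡y = inj₂ x⁺≡y
  ... | no x⁺≢y = inj₁ (⇒-sucC {x} {y} (⇒⁼-strict x⇒⁼y x≢y) x⁺≢y)

  ⇒⁼-sucC-target : ∀ {x y} → x ⇒⁼ sucC y → sucC y ≢ x → x ⇒⁼ y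
  ⇒⁼-sucC-target {x} {y} x⇒⁼y⁺ y⁺≢x =
    ⇒⁼-shorten {x} {sucC y} {y} x⇒⁼y⁺ (subst (dist x y ≤_) (sym (dist-sucC x y y⁺≢x)) (n≤1+n (dist x y)))

  Fr-≡ : ∀ {x w} → sucC w ≢ x → x ⇒⁼ w → ¬ x ⇒ sucC w → Fr x ≡ w
  Fr-≡ {x} {w} w⁺≢x x⇒⁼w ¬x⇒w⁺ = dist-injectiveʳ {i = x} (≤-antisym (≮⇒≥ overshoot) (⇒⁼-dist x⇒⁼w))
    where
      overshoot : ¬ dist x w < dist x (Fr x)
      overshoot xw<xFr =
        ¬x⇒w⁺ (subst (0 <_) (sym xw⁺≡) (s≤s z≤n) , subst (_≤ dist x (Fr x)) (sym xw⁺≡) xw<xFr)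
        where
          xw⁺≡ : dist x (sucC w) ≡ suc (dist x w)
          xw⁺≡ = dist-sucC x w w⁺≢x

  connectable : ∀ {x y} → Apart x y → sucC x ⇒⁼ y → x ⇒⁼ predC y → Connectable Φ x y
  connectable {x} {y} (x≢y , ¬adj) x⁺⇒⁼y x⇒⁼y⁻ =
    x≢y , y≡Ur , sucC x , (x⁺⇒⁼y , inj₂ (¬x⇒y ∘ subst (_⇒ y) (predC-sucC x))) , sym (predC-sucC x)
    where
      ¬x⇒y : ¬ x ⇒ y
      ¬x⇒y = ¬adj ∘ inj₁
      Fr≡ : Fr x ≡ predC y
      Fr≡ = Fr-≡ (λ eq → x≢y (trans (sym eq) (sucC-predC y)))
                 x⇒⁼y⁻ (¬x⇒y ∘ subst (x ⇒_) (sucC-predC y))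
      y≡Ur : y ≡ Ur Φ x
      y≡Ur = trans (sym (sucC-predC y)) (cong sucC (sym Fr≡))

  data Side (b w : Fin K) : Set where
    before : sucC b ⇒⁼ w → ¬ sucC w ⇒⁼ b → Side b w
    after  : w ⇒⁼ predC b → ¬ b ⇒⁼ predC w → Side b w
    at     : sucC b ⇒⁼ w → w ⇒⁼ predC b → Side b w

  sides-connectable : ∀ {b w} → Apart b w → Side b w → Side w b →
                      Connectable Φ b w ⊎ Connectable Φ w b
  sides-connectable ap (before b⁺w _)  (after b⇒⁼w⁻ _) = inj₁ (connectable ap b⁺w b⇒⁼w⁻)
  sides-connectable ap (at b⁺w _)      (after b⇒⁼w⁻ _) = inj₁ (connectable ap b⁺w b⇒⁼w⁻)
  sides-connectable ap (at b⁺w _)      (at _ b⇒⁼w⁻)    = inj₁ (connectable ap b⁺w b⇒⁼w⁻)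
  sides-connectable ap (after w⇒⁼b⁻ _) (before w⁺b _)  = inj₂ (connectable (apart-sym ap) w⁺b w⇒⁼b⁻)
  sides-connectable ap (at _ w⇒⁼b⁻)    (before w⁺b _)  = inj₂ (connectable (apart-sym ap) w⁺b w⇒⁼b⁻)
  sides-connectable _  (before _ ¬w⁺b) (before w⁺b _)  = ⊥-elim (¬w⁺b w⁺b)
  sides-connectable _  (before _ ¬w⁺b) (at w⁺b _)      = ⊥-elim (¬w⁺b w⁺b)
  sides-connectable _  (after _ ¬b⇒⁼w⁻) (after b⇒⁼w⁻ _) = ⊥-elim (¬b⇒⁼w⁻ b⇒⁼w⁻)
  sides-connectable _  (after _ ¬b⇒⁼w⁻) (at _ b⇒⁼w⁻)    = ⊥-elim (¬b⇒⁼w⁻ b⇒⁼w⁻)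

  GAdj-sym : Symmetric (GAdj Φ)
  GAdj-sym (x≢y , inj₁ bx≡by) = x≢y ∘ sym , inj₁ (sym bx≡by)
  GAdj-sym (x≢y , inj₂ adj)   = x≢y ∘ sym , inj₂ (swap adj)

  compl-apart : ∀ {x y} → Apart (blk x) (blk y) → Compl (GAdj Φ) x y
  compl-apart (bx≢by , ¬adj) = bx≢by ∘ cong blk , [ bx≢by , ¬adj ]′ ∘ proj₂

  rep : Fin K → Fin n
  rep b = proj₁ (nonempty b)

  blk-rep : ∀ b → blk (rep b) ≡ b
  blk-rep b = proj₂ (nonempty b)

  module Around (B : Fin K) where
    p : Fin K → ℕ
    p = dist B

    Far : Fin K → Set
    Far = Apart B

    p>0 : ∀ {x} → B ≢ x → 0 < p x
    p>0 B≢x = n≢0⇒n>0 (B≢x ∘ dist≡0⇒≡ {i = B})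

    p≤ : ∀ x → p x ≤ suc m
    p≤ x = s≤s⁻¹ (dist< B x)

    p-sucC : ∀ {x} → sucC x ≢ B → p (sucC x) ≡ suc (p x)
    p-sucC {x} = dist-sucC B x

    p-predC : ∀ {x} → B ≢ x → p x ≡ suc (p (predC x))
    p-predC {x} B≢x =
      trans (cong p (sym (sucC-predC x))) (p-sucC (λ eq → B≢x (sym (trans (sym (sucC-predC x)) eq))))

    far-convex : ∀ {x y z} → Far y → Far z → p y ≤ p x → p x ≤ p z → Far x
    far-convex {x} {y} {z} (B≢y , ¬By) (B≢z , ¬Bz) y≤x x≤z = B≢x , [ ¬B⇒x , ¬x⇒B ]′
      where
        B≢x : B ≢ x
        B≢x refl = B≢y (dist≡0⇒≡ {i = B} (n≤0⇒n≡0 (subst (p y ≤_) (dist-refl B) y≤x)))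
        ¬B⇒x : ¬ B ⇒ x
        ¬B⇒x B⇒x = ¬By (inj₁ (⇒⁼-strict (⇒⁼-shorten {B} {x} {y} (inj₁ B⇒x) y≤x) B≢y))
        xz≤xB : dist x z ≤ dist x B
        xz≤xB = +-cancelˡ-≤ (p x) _ _ (begin
          p x + dist x z  ≡⟨ dist-split B x z x≤z ⟨
          p z             ≤⟨ <⇒≤ (dist< B z) ⟩
          K               ≡⟨ dist-sum B≢x ⟨
          p x + dist x B  ∎)
          where open ≤-Reasoning
        ¬x⇒B : ¬ x ⇒ B
        ¬x⇒B x⇒B = ¬Bz (inj₂ (⇒⁼-strict (⇒⁼-between {x} {B} {z} (inj₁ x⇒B) xz≤xB) (B≢z ∘ sym)))

    Consecutive : Fin K → Fin K → Set
    Consecutive u u' = u' ≡ u ⊎ u' ≡ sucC u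

    Separated : Fin K → Fin K → Set
    Separated u u' = ∀ z → z ≢ B → ¬ (Apart z u × Apart z u')

    Break : Set
    Break = Σ[ u ∈ Fin K ] Σ[ u' ∈ Fin K ] Far u × Far u' × Consecutive u u' × Separated u u'

    break? : Dec Break
    break? = Finₚ.any? λ u → Finₚ.any? λ u' →
      apart? B u ×-dec apart? B u' ×-dec (u' Finₚ.≟ u ⊎-dec u' Finₚ.≟ sucC u) ×-dec
      Finₚ.all? (λ z → ¬? (z Finₚ.≟ B) →-dec ¬? (apart? z u ×-dec apart? z u'))

    apart-sucC : ∀ {y} → Far y → ¬ sucC B ⇒⁼ y → Apart (sucC B) y
    apart-sucC {y} (B≢y , ¬By) ¬B⁺y = B⁺≢y , [ ¬B⁺y ∘ inj₁ , ¬y⇒B⁺ ]′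
      where
        B⁺≢y : sucC B ≢ y
        B⁺≢y = ¬B⁺y ∘ inj₂
        ¬y⇒B⁺ : ¬ y ⇒ sucC B
        ¬y⇒B⁺ y⇒B⁺ = ¬By (inj₂ (⇒⁼-strict (⇒⁼-sucC-target (inj₁ y⇒B⁺) B⁺≢y) (B≢y ∘ sym)))

    apart-predC : ∀ {y} → Far y → ¬ y ⇒⁼ predC B → Apart (predC B) y
    apart-predC {y} (B≢y , ¬By) ¬yB⁻ = ¬yB⁻ ∘ inj₂ ∘ sym , [ ¬B⁻⇒y , ¬yB⁻ ∘ inj₁ ]′
      where
        ¬B⁻⇒y : ¬ predC B ⇒ y
        ¬B⁻⇒y B⁻⇒y = ¬By (inj₁ (subst (_⇒ y) (sucC-predC B)
          (⇒-sucC {predC B} {y} B⁻⇒y (λ eq → B≢y (trans (sym (sucC-predC B)) eq)))))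

    -- Otherwise sucC B would be apart from both u and u'.
    break-left : ∀ {u u'} → Far u → Far u' → Consecutive u u' → Separated u u' → sucC B ⇒⁼ u
    break-left {u} {u'} fu fu' cons sep with sucC B ⇒⁼? u
    ... | yes B⁺u = B⁺u
    ... | no ¬B⁺u =
      ⊥-elim (sep (sucC B) (sucC≢ B) (apart-sucC fu ¬B⁺u , apart-sucC fu' (¬B⁺u ∘ back cons)))
      where
        back : ∀ {w} → Consecutive u w → sucC B ⇒⁼ w → sucC B ⇒⁼ u
        back (inj₁ refl) B⁺u = B⁺u
        back (inj₂ refl) B⁺u⁺ = ⇒⁼-sucC-target B⁺u⁺ (λ eq → proj₁ fu (sym (sucC-injective eq)))

    break-right : ∀ {u u'} → Far u → Far u' → Consecutive u u' → Separated u u' → u' ⇒⁼ predC B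
    break-right {u} {u'} fu fu' cons sep with u' ⇒⁼? predC B
    ... | yes u'B⁻ = u'B⁻
    ... | no ¬u'B⁻ =
      ⊥-elim (sep (predC B) (predC≢ B) (apart-predC fu (¬u'B⁻ ∘ forward fu' cons) , apart-predC fu' ¬u'B⁻))
      where
        forward : ∀ {w} → Far w → Consecutive u w → u ⇒⁼ predC B → w ⇒⁼ predC B
        forward _ (inj₁ refl) uB⁻ = uB⁻
        forward fw (inj₂ refl) uB⁻ with u Finₚ.≟ predC B
        ... | yes u≡B⁻ = ⊥-elim (proj₁ fw (sym (trans (cong sucC u≡B⁻) (sucC-predC B))))
        ... | no u≢B⁻ = ⇒⁼-sucC-source uB⁻ u≢B⁻

    reach-left : ∀ {u W} → Far u → sucC B ⇒⁼ u → B ≢ W → p W ≤ p u → sucC B ⇒⁼ W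
    reach-left {u} {W} (B≢u , _) B⁺u B≢W W≤u = ⇒⁼-shorten {sucC B} {u} {W} B⁺u
      (s≤s⁻¹ (subst₂ _≤_ (dist-stepˡ {x = B} {y = W} (p>0 B≢W)) (dist-stepˡ {x = B} {y = u} (p>0 B≢u)) W≤u))

    reach-right : ∀ {u' W} → u' ⇒⁼ predC B → p u' ≤ p W → W ⇒⁼ predC B
    reach-right {u'} {W} u'B⁻ u'≤W = ⇒⁼-between {u'} {predC B} {W} u'B⁻ (+-cancelˡ-≤ (p u') _ _ (begin
      p u' + dist u' W          ≡⟨ dist-split B u' W u'≤W ⟨
      p W                       ≤⟨ W≤B⁻ ⟩
      p (predC B)               ≡⟨ dist-split B u' (predC B) (≤-trans u'≤W W≤B⁻) ⟩
      p u' + dist u' (predC B)  ∎))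
      where
        open ≤-Reasoning
        W≤B⁻ : p W ≤ p (predC B)
        W≤B⁻ = subst (p W ≤_) (sym (dist-predC-self B)) (p≤ W)

    not-left : ∀ {y W} → Far y → Far W → p W < p y → ¬ sucC W ⇒⁼ B
    not-left {y} {W} _ _ W<y (inj₂ W⁺≡B) = <⇒≱ W<y (subst (p y ≤_) (sym pW≡) (p≤ y))
      where
        pW≡ : p W ≡ suc m
        pW≡ = trans (cong p (trans (sym (predC-sucC W)) (cong predC W⁺≡B))) (dist-predC-self B)
    not-left {y} {W} fy fW W<y (inj₁ W⁺⇒B) = proj₂ fW⁺ (inj₂ W⁺⇒B)
      where
        pW⁺≡ : p (sucC W) ≡ suc (p W)
        pW⁺≡ = p-sucC (⇒-irrefl {sucC W} {B} W⁺⇒B)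
        fW⁺ : Far (sucC W)
        fW⁺ = far-convex fW fy (subst (p W ≤_) (sym pW⁺≡) (n≤1+n (p W))) (subst (_≤ p y) (sym pW⁺≡) W<y)

    not-right : ∀ {y W} → Far y → Far W → p y < p W → ¬ B ⇒⁼ predC W
    not-right {y} {W} (B≢y , _) _ y<W (inj₂ B≡W⁻) = <⇒≱ y<W (subst (_≤ p y) (sym pW≡1) (p>0 B≢y))
      where
        pW≡1 : p W ≡ 1
        pW≡1 = trans (cong p (trans (sym (sucC-predC W)) (cong sucC (sym B≡W⁻)))) (dist-sucC-self B)
    not-right {y} {W} fy fW y<W (inj₁ B⇒W⁻) = proj₂ fW⁻ (inj₁ B⇒W⁻)
      where
        pW≡ : p W ≡ suc (p (predC W))
        pW≡ = p-predC (proj₁ fW)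
        fW⁻ : Far (predC W)
        fW⁻ = far-convex fy fW (s≤s⁻¹ (subst (p y <_) pW≡ y<W)) (subst (p (predC W) ≤_) (sym pW≡) (n≤1+n _))

    consecutive-p : ∀ {u u'} → Far u' → Consecutive u u' → p u' ≤ suc (p u)
    consecutive-p _ (inj₁ refl) = n≤1+n _
    consecutive-p (B≢u' , _) (inj₂ refl) = ≤-reflexive (p-sucC (B≢u' ∘ sym))

    side : ∀ {W} → Break → Far W → Side B W
    side {W} (u , u' , fu , fu' , cons , sep) fW
      with break-left fu fu' cons sep | break-right fu fu' cons sep
         | <-≤-connex (p u) (p W) | <-≤-connex (p W) (p u')
    ... | _  | B⁻ | inj₁ u<W | _ =
      after (reach-right B⁻ (≤-trans (consecutive-p fu' cons) u<W)) (not-right fu fW u<W)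
    ... | B⁺ | _  | inj₂ W≤u | inj₁ W<u' = before (reach-left fu B⁺ (proj₁ fW) W≤u) (not-left fu' fW W<u')
    ... | B⁺ | B⁻ | inj₂ W≤u | inj₂ u'≤W = at (reach-left fu B⁺ (proj₁ fW) W≤u) (reach-right B⁻ u'≤W)

    CommonNonNeighbour : Fin K → Fin K → Set
    CommonNonNeighbour u u' = Σ[ z ∈ Fin K ] z ≢ B × Apart z u × Apart z u'

    common-non-neighbour : ¬ Break → ∀ {u u'} → Far u → Far u' → Consecutive u u' →
                           CommonNonNeighbour u u'
    common-non-neighbour ¬br {u} {u'} fu fu' cons
      with Finₚ.any? (λ z → ¬? (z Finₚ.≟ B) ×-dec apart? z u ×-dec apart? z u')
    ... | yes found = found
    ... | no none = ⊥-elim (¬br (u , u' , fu , fu' , cons , λ z z≢B zuu' → none (z , z≢B , zuu')))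

    module _ (¬br : ¬ Break) {v : Fin n} (v∈B : blk v ≡ B) where
      open DeleteVertex Finₚ._≟_ (GAdj Φ) GAdj-sym v

      ≢v : ∀ {x} → blk x ≢ B → x ≢ v
      ≢v bx≢B refl = bx≢B v∈B

      joined-common : ∀ {c d} → CommonNonNeighbour (blk c) (blk d) → Joined c d
      joined-common {c} {d} (z , z≢B , zc , zd) = joined-trans (≢v (z≢B ∘ trans (sym (blk-rep z))))
        (joined-edge (compl-apart (apart-sym (subst (λ b → Apart b (blk c)) (sym (blk-rep z)) zc))))
        (joined-edge (compl-apart (subst (λ b → Apart b (blk d)) (sym (blk-rep z)) zd)))

      far-joined-by : ∀ t {c d} → Far (blk c) → Far (blk d) → p (blk d) ≡ p (blk c) + t → Joined c d
      far-joined-by zero {c} {d} fc _ d≡c+0 =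
        joined-common (subst (CommonNonNeighbour (blk c)) (sym bd≡bc)
          (common-non-neighbour ¬br fc fc (inj₁ refl)))
        where
          bd≡bc : blk d ≡ blk c
          bd≡bc = dist-injectiveʳ {i = B} (trans d≡c+0 (+-identityʳ _))
      far-joined-by (suc t) {c} {d} fc fd d≡c+1+t =
        joined-trans (≢v (proj₁ fy ∘ sym)) (far-joined-by t fc fy (trans (cong p (blk-rep b)) pb≡))
          (joined-common (subst (λ x → CommonNonNeighbour x (blk d)) (sym (blk-rep b))
            (common-non-neighbour ¬br fb fd (inj₂ (sym (sucC-predC (blk d)))))))
        where
          b = predC (blk d)
          pd≡ : p (blk d) ≡ suc (p b)
          pd≡ = p-predC (proj₁ fd)
          pb≡ : p b ≡ p (blk c) + t
          pb≡ = suc-injective (trans (sym pd≡) (trans d≡c+1+t (+-suc _ t)))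
          fb : Far b
          fb = far-convex fc fd (subst (p (blk c) ≤_) (sym pb≡) (m≤m+n _ t))
                                (subst (p b ≤_) (sym pd≡) (n≤1+n _))
          fy : Far (blk (rep b))
          fy = subst Far (sym (blk-rep b)) fb

      far-joined : ∀ {c d} → Far (blk c) → Far (blk d) → Joined c d
      far-joined {c} {d} fc fd with ≤-total (p (blk c)) (p (blk d))
      ... | inj₁ c≤d = far-joined-by _ fc fd (sym (m+[n∸m]≡n c≤d))
      ... | inj₂ d≤c = joined-sym (far-joined-by _ fd fc (sym (m+[n∸m]≡n d≤c)))

      far-of-compl : ∀ {c} → Compl (GAdj Φ) v c → Far (blk c)
      far-of-compl {c} (v≢c , ¬vc) = (λ B≡c → ¬vc (v≢c , inj₁ (trans v∈B B≡c))) ,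
                                      (λ adj → ¬vc (v≢c , inj₂ (subst (λ b → RAdj Φ b (blk c)) (sym v∈B) adj)))

      deletion-coConnected : CoConnected (GAdj Φ) → CoConnected (DelVertex (GAdj Φ) v)
      deletion-coConnected coConn =
        coConnected-deleteVertex coConn (λ va vb → far-joined (far-of-compl va) (far-of-compl vb))

    break-of-deletion : ∀ {v} → blk v ≡ B → CoConnected (GAdj Φ) →
                        ¬ CoConnected (DelVertex (GAdj Φ) v) → Break
    break-of-deletion v∈B coConn ¬coConn with break?
    ... | yes br = br
    ... | no ¬br = ⊥-elim (¬coConn (deletion-coConnected ¬br v∈B coConn))

lemma38 : (n k : ℕ) (Φ : RoundRep n k) → IsBlockContig Φ →
    (B W : Fin k) → B ≢ W → ¬ RAdj Φ B W →
    (v w : Fin n) → RoundRep.blk Φ v ≡ B → RoundRep.blk Φ w ≡ W →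
    IsPCA (AddEdge (GAdj Φ) v w) → ¬ IsPIG (AddEdge (GAdj Φ) v w) →
    CoConnected (GAdj Φ) →
    ¬ CoConnected (DelVertex (GAdj Φ) v) → ¬ CoConnected (DelVertex (GAdj Φ) w) →
    Connectable Φ B W ⊎ Connectable Φ W B
lemma38 n zero Φ _ () _ _ _ _ _ _ _ _ _ _ _ _
lemma38 n (suc zero) Φ _ Fin.zero Fin.zero B≢W _ _ _ _ _ _ _ _ _ _ = ⊥-elim (B≢W refl)
lemma38 n (suc (suc m)) Φ _ B W B≢W ¬adj v w v∈B w∈W _ _ coConn ¬coConn-v ¬coConn-w =
  sides-connectable B-W (Around.side B (Around.break-of-deletion B v∈B coConn ¬coConn-v) B-W)
                        (Around.side W (Around.break-of-deletion W w∈W coConn ¬coConn-w) (apart-sym B-W))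
  where
    open RoundRepFacts Φ
    B-W : Apart B W
    B-W = B≢W , ¬adj
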